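{- Let $t \geq 1$ and $k \geq 1$ be integers, and let $C_n = \frac{1}{n+1}\binom{2n}{n}$ denote the $n$-th Catalan number. Then $$\#\{n \in \mathbb{Z}_{>0} : n < 2^t,\ C_n \equiv 2^{k-1} \pmod{2^k}\} = \binom{t}{k}.$$
   Context: $C_n = \frac{1}{n+1}\binom{2n}{n}$ is the $n$-th Catalan number. -}

module Defs where

open import Data.Nat using (ℕ; suc; _+_; _*_; _^_; _∸_; _<_)
open import Data.Nat.DivMod using (_/_; _%_)
open import Data.Nat.Combinatorics using (_C_)
open import Data.Nat.Properties using (_≟_; m^n≢0)
open import Data.List using (List; length; filter; upTo; drop)
open import Relation.Nullary.Decidable using (Dec)
open import Relation.Binary.PropositionalEquality using (_≡_)

-- n-th Catalan number C_n = (1/(n+1)) * binom(2n, n)  (the division is exact)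
catalan : ℕ → ℕ
catalan n = ((2 * n) C n) / suc n

positivesBelow : ℕ → List ℕ
positivesBelow N = drop 1 (upTo N)

catalanCount : ℕ → ℕ → ℕ
catalanCount t k =
  let instance _ = m^n≢0 2 k in
  length (filter (λ n → (catalan n % (2 ^ k)) ≟ ((2 ^ (k ∸ 1)) % (2 ^ k)))
                 (positivesBelow (2 ^ t)))

-- Write s(n) for the number of ones in the binary expansion of n and ν₂ for
-- the 2-adic valuation.  The proof has three layers.
--
-- 1. Legendre's formula ν₂(m!) = m - s(m), obtained from the carry rule
--    ν₂(m+1) = s(m) + 1 - s(m+1).  Since (2n)! = C(2n,n)·n!·n! and
--    s(2n) = s(n), this gives Kummer's special case ν₂ C(2n,n) = s(n); as
--    C(2n,n) = (n+1)·C_n we get ν₂(C_n) = s(n+1) - 1.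
-- 2. C ≡ 2^a (mod 2^(a+1)) holds exactly when ν₂(C) = a, so
--    C_n ≡ 2^(k-1) (mod 2^k) iff s(n+1) = k.
-- 3. Among 0 ≤ m < 2^t exactly C(t,k) numbers have s(m) = k (split into
--    even and odd m and use Pascal's rule).  Shifting the range
--    1 ≤ n < 2^t to 2 ≤ n+1 ≤ 2^t changes nothing, because s(1) = s(2^t).
module Submission where

open import Defs
open import Data.Bool using (Bool; true; false)
open import Data.Empty using (⊥-elim)
open import Data.List using (length; filter; applyUpTo)
open import Data.Nat
open import Data.Nat.Combinatorics
  using (_C_; nCk≡n!/k![n-k]!; k![n∸k]!∣n!; nCk+nC[k+1]≡[n+1]C[k+1]; [n-k]*d[k+1]≡[k+1]*d[k])
open import Data.Nat.Divisibility using (_∣_; divides)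
open import Data.Nat.DivMod
open import Data.Nat.Induction using (<-rec)
open import Data.Nat.Properties
open import Data.Nat.Tactic.RingSolver using (solve-∀)
open import Data.Product using (∃-syntax; _×_; _,_; proj₁; proj₂)
open import Data.Sum using (_⊎_; inj₁; inj₂)
open import Function.Bundles using (_⇔_; mk⇔; Equivalence)
open import Relation.Nullary using (does)
open import Relation.Nullary.Decidable using (does-⇔)
open import Relation.Unary using (Pred; Decidable)
open import Level using (0ℓ)
open import Relation.Binary.PropositionalEquality

-- Parity and the 2-adic valuation

double-suc : ∀ q → 2 * suc q ≡ suc (suc (2 * q))
double-suc = solve-∀

even-or-odd : ∀ x → ∃[ q ] (x ≡ 2 * q ⊎ x ≡ suc (2 * q))
even-or-odd zero = 0 , inj₁ refl
even-or-odd (suc x) with even-or-odd x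
... | q , inj₁ even = q , inj₂ (cong suc even)
... | q , inj₂ odd  = suc q , inj₁ (trans (cong suc odd) (sym (double-suc q)))

odd≢even : ∀ q r → suc (2 * q) ≢ 2 * r
odd≢even q r eq = 1+n≢0 (begin
  1                 ≡⟨ [m+kn]%n≡m%n 1 q 2 ⟨
  (1 + q * 2) % 2   ≡⟨ cong (λ m → suc m % 2) (*-comm q 2) ⟩
  suc (2 * q) % 2   ≡⟨ cong (_% 2) eq ⟩
  2 * r % 2         ≡⟨ cong (_% 2) (*-comm 2 r) ⟩
  r * 2 % 2         ≡⟨ m*n%n≡0 r 2 ⟩
  0                 ∎)
  where open ≡-Reasoning

Odd : ℕ → Set
Odd o = ∃[ q ] o ≡ suc (2 * q)

infix 4 ν₂[_]≡_
ν₂[_]≡_ : ℕ → ℕ → Set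
ν₂[ x ]≡ a = ∃[ o ] Odd o × x ≡ 2 ^ a * o

ν₂-odd : ∀ q → ν₂[ suc (2 * q) ]≡ 0
ν₂-odd q = suc (2 * q) , (q , refl) , sym (*-identityˡ _)

ν₂-double : ∀ {x a} → ν₂[ x ]≡ a → ν₂[ 2 * x ]≡ suc a
ν₂-double {x} {a} (o , odd , x≡) = o , odd , trans (cong (2 *_) x≡) (sym (*-assoc 2 (2 ^ a) o))

-- ν₂ is additive: a product of odd numbers is odd.
ν₂-mul : ∀ {x y a b} → ν₂[ x ]≡ a → ν₂[ y ]≡ b → ν₂[ x * y ]≡ a + b
ν₂-mul {x} {y} {a} {b} (o , (q , o≡) , x≡) (o′ , (r , o′≡) , y≡) =
  o * o′ , (q + r + 2 * q * r , trans (cong₂ _*_ o≡ o′≡) (odd*odd q r)) ,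
  (begin
    x * y                        ≡⟨ cong₂ _*_ x≡ y≡ ⟩
    (2 ^ a * o) * (2 ^ b * o′)   ≡⟨ interchange (2 ^ a) (2 ^ b) o o′ ⟩
    (2 ^ a * 2 ^ b) * (o * o′)   ≡⟨ cong (_* (o * o′)) (^-distribˡ-+-* 2 a b) ⟨
    2 ^ (a + b) * (o * o′)       ∎)
  where
  open ≡-Reasoning
  odd*odd : ∀ q r → suc (2 * q) * suc (2 * r) ≡ suc (2 * (q + r + 2 * q * r))
  odd*odd = solve-∀
  interchange : ∀ p q x y → (p * x) * (q * y) ≡ (p * q) * (x * y)
  interchange = solve-∀

ν₂-unique : ∀ {x a b} → ν₂[ x ]≡ a → ν₂[ x ]≡ b → a ≡ b
ν₂-unique {a = a} {b} (o , odd , x≡) (o′ , odd′ , x≡′) = exponents a b odd odd′ (trans (sym x≡) x≡′)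
  where
  exponents : ∀ a b {o o′} → Odd o → Odd o′ → 2 ^ a * o ≡ 2 ^ b * o′ → a ≡ b
  exponents zero zero _ _ _ = refl
  exponents zero (suc b) {o} {o′} (q , o≡) _ eq =
    ⊥-elim (odd≢even q (2 ^ b * o′) (trans (sym o≡) (trans (sym (*-identityˡ o)) (trans eq (*-assoc 2 (2 ^ b) o′)))))
  exponents (suc a) zero odd odd′ eq = sym (exponents zero (suc a) odd′ odd (sym eq))
  exponents (suc a) (suc b) {o} {o′} odd odd′ eq = cong suc (exponents a b odd odd′
    (*-cancelˡ-≡ _ _ 2 (trans (sym (*-assoc 2 (2 ^ a) o)) (trans eq (*-assoc 2 (2 ^ b) o′)))))

ν₂-exists : ∀ x → x ≢ 0 → ∃[ a ] ν₂[ x ]≡ a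
ν₂-exists = <-rec (λ x → x ≢ 0 → ∃[ a ] ν₂[ x ]≡ a) step
  where
  step : ∀ x → (∀ {y} → y < x → y ≢ 0 → ∃[ a ] ν₂[ y ]≡ a) → x ≢ 0 → ∃[ a ] ν₂[ x ]≡ a
  step x rec x≢0 with even-or-odd x
  ... | q , inj₂ x≡ = 0 , subst (ν₂[_]≡ 0) (sym x≡) (ν₂-odd q)
  ... | zero , inj₁ x≡ = ⊥-elim (x≢0 x≡)
  ... | suc q , inj₁ x≡ with rec (subst (suc q <_) (sym x≡) (m<m+n (suc q) z<s)) (λ ())
  ...   | a , val = suc a , subst (ν₂[_]≡ suc a) (sym x≡) (ν₂-double {a = a} val)

-- Binary digit sum

-- digitSumWithin f n adds up the last f binary digits of n; once f ≥ n
-- these are all of them.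
digitSumWithin : ℕ → ℕ → ℕ
digitSumWithin zero    n = 0
digitSumWithin (suc f) n = n % 2 + digitSumWithin f ⌊ n /2⌋

s : ℕ → ℕ
s n = digitSumWithin n n

digitSumWithin-zero : ∀ f → digitSumWithin f 0 ≡ 0
digitSumWithin-zero zero    = refl
digitSumWithin-zero (suc f) = digitSumWithin-zero f

digitSumWithin-stable : ∀ f g n → n ≤ f → n ≤ g → digitSumWithin f n ≡ digitSumWithin g n
digitSumWithin-stable zero    g       zero _ _   = sym (digitSumWithin-zero g)
digitSumWithin-stable (suc f) zero    zero _ _   = digitSumWithin-zero (suc f)
digitSumWithin-stable (suc f) (suc g) n n≤f n≤g =
  cong (n % 2 +_) (digitSumWithin-stable f g ⌊ n /2⌋ (halve n≤f) (halve n≤g))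
  where
  halve : ∀ {n f} → n ≤ suc f → ⌊ n /2⌋ ≤ f
  halve {zero}  _   = z≤n
  halve {suc n} n≤f = ≤-pred (≤-trans (⌊n/2⌋<n n) n≤f)

s-unfold : ∀ m → s m ≡ m % 2 + s ⌊ m /2⌋
s-unfold m = trans (digitSumWithin-stable m (suc m) m ≤-refl (n≤1+n m))
  (cong (m % 2 +_) (digitSumWithin-stable m ⌊ m /2⌋ ⌊ m /2⌋ (⌊n/2⌋≤n m) ≤-refl))

s-even : ∀ j → s (2 * j) ≡ s j
s-even j = begin
  s (2 * j)                     ≡⟨ s-unfold (2 * j) ⟩
  2 * j % 2 + s ⌊ 2 * j /2⌋     ≡⟨ cong₂ (λ r h → r + s h) (trans (cong (_% 2) (*-comm 2 j)) (m*n%n≡0 j 2)) half ⟩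
  s j                           ∎
  where
  open ≡-Reasoning
  half : ⌊ 2 * j /2⌋ ≡ j
  half = sym (trans (n≡⌊n+n/2⌋ j) (cong (λ m → ⌊ j + m /2⌋) (sym (+-identityʳ j))))

s-odd : ∀ j → s (suc (2 * j)) ≡ suc (s j)
s-odd j = begin
  s (suc (2 * j))                         ≡⟨ s-unfold (suc (2 * j)) ⟩
  suc (2 * j) % 2 + s ⌊ suc (2 * j) /2⌋   ≡⟨ cong₂ (λ r h → r + s h) (trans (cong (λ m → suc m % 2) (*-comm 2 j)) ([m+kn]%n≡m%n 1 j 2)) (half j) ⟩
  suc (s j)                               ∎
  where
  open ≡-Reasoning
  half : ∀ j → ⌊ suc (2 * j) /2⌋ ≡ j
  half zero    = refl
  half (suc j) = trans (cong (λ m → ⌊ suc m /2⌋) (double-suc j)) (cong suc (half j))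

s-pow2 : ∀ t → s (2 ^ t) ≡ 1
s-pow2 zero    = refl
s-pow2 (suc t) = trans (s-even (2 ^ t)) (s-pow2 t)

-- Legendre's formula

-- The carry rule: adding 1 to m turns its ν₂(m+1) trailing ones into zeros
-- and one zero into a one.
ν₂-suc : ∀ m → ∃[ b ] ν₂[ suc m ]≡ b × s m + 1 ≡ s (suc m) + b
ν₂-suc = <-rec (λ m → ∃[ b ] ν₂[ suc m ]≡ b × s m + 1 ≡ s (suc m) + b) step
  where
  step : ∀ m → (∀ {y} → y < m → ∃[ b ] ν₂[ suc y ]≡ b × s y + 1 ≡ s (suc y) + b) →
         ∃[ b ] ν₂[ suc m ]≡ b × s m + 1 ≡ s (suc m) + b
  step m rec with even-or-odd m
  ... | j , inj₁ refl = 0 , ν₂-odd j , (begin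
    s (2 * j) + 1         ≡⟨ cong (_+ 1) (s-even j) ⟩
    s j + 1               ≡⟨ +-comm (s j) 1 ⟩
    suc (s j)             ≡⟨ s-odd j ⟨
    s (suc (2 * j))       ≡⟨ +-identityʳ _ ⟨
    s (suc (2 * j)) + 0   ∎)
    where open ≡-Reasoning
  ... | j , inj₂ refl with rec {j} (s≤s (m≤m+n j (j + 0)))
  ...   | b , val , carry = suc b , subst (ν₂[_]≡ suc b) (double-suc j) (ν₂-double {a = b} val) , (begin
    s (suc (2 * j)) + 1           ≡⟨ cong (_+ 1) (s-odd j) ⟩
    suc (s j + 1)                 ≡⟨ cong suc carry ⟩
    suc (s (suc j) + b)           ≡⟨ +-suc (s (suc j)) b ⟨
    s (suc j) + suc b             ≡⟨ cong (_+ suc b) (s-even (suc j)) ⟨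
    s (2 * suc j) + suc b         ≡⟨ cong (λ m → s m + suc b) (double-suc j) ⟩
    s (suc (suc (2 * j))) + suc b ∎)
    where open ≡-Reasoning

ν₂-factorial : ∀ m → ∃[ a ] ν₂[ m ! ]≡ a × a + s m ≡ m
ν₂-factorial zero = 0 , ν₂-odd 0 , refl
ν₂-factorial (suc m) with ν₂-factorial m | ν₂-suc m
... | a , val-m! , legendre | b , val-suc , carry = b + a , ν₂-mul {a = b} val-suc val-m! , (begin
  b + a + s (suc m)     ≡⟨ rearrange b a (s (suc m)) ⟩
  a + (s (suc m) + b)   ≡⟨ cong (a +_) carry ⟨
  a + (s m + 1)         ≡⟨ +-assoc a (s m) 1 ⟨
  a + s m + 1           ≡⟨ cong (_+ 1) legendre ⟩
  m + 1                 ≡⟨ +-comm m 1 ⟩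
  suc m                 ∎)
  where
  open ≡-Reasoning
  rearrange : ∀ b a c → b + a + c ≡ a + (c + b)
  rearrange = solve-∀

-- Binomial coefficients

binomial-factorials : ∀ {n k} → k ≤ n → (n C k) * (k ! * (n ∸ k) !) ≡ n !
binomial-factorials {n} {k} k≤n =
  trans (cong (_* (k ! * (n ∸ k) !)) (nCk≡n!/k![n-k]! k≤n)) (m/n*n≡m (k![n∸k]!∣n! k≤n))
  where instance _ = k !* (n ∸ k) !≢0

-- Absorption: (k+1) · C(n,k+1) = (n-k) · C(n,k) for k < n.  Both sides times
-- k!·(n-k)! equal (n-k) · n!.
binomial-absorption : ∀ {n k} → k < n → suc k * (n C suc k) ≡ (n ∸ k) * (n C k)
binomial-absorption {n} {k} k<n = *-cancelʳ-≡ _ _ (k ! * (n ∸ k) !) (begin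
  suc k * y * d[k]            ≡⟨ swap-outer (suc k) y d[k] ⟩
  y * (suc k * d[k])          ≡⟨ cong (y *_) ([n-k]*d[k+1]≡[k+1]*d[k] k<n) ⟨
  y * ((n ∸ k) * d[k+1])      ≡⟨ swap-outer′ y (n ∸ k) d[k+1] ⟩
  (n ∸ k) * (y * d[k+1])      ≡⟨ cong ((n ∸ k) *_) (binomial-factorials k<n) ⟩
  (n ∸ k) * n !               ≡⟨ cong ((n ∸ k) *_) (binomial-factorials (<⇒≤ k<n)) ⟨
  (n ∸ k) * (x * d[k])        ≡⟨ *-assoc (n ∸ k) x d[k] ⟨
  (n ∸ k) * x * d[k]          ∎)
  where
  open ≡-Reasoning
  instance _ = k !* (n ∸ k) !≢0
  x = n C k
  y = n C suc k
  d[k] = k ! * (n ∸ k) !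
  d[k+1] = suc k ! * (n ∸ suc k) !
  swap-outer : ∀ p y d → p * y * d ≡ y * (p * d)
  swap-outer = solve-∀
  swap-outer′ : ∀ y p d → y * (p * d) ≡ p * (y * d)
  swap-outer′ = solve-∀

2*n≡n+n : ∀ n → 2 * n ≡ n + n
2*n≡n+n n = cong (n +_) (+-identityʳ n)

2n∸n≡n : ∀ n → 2 * n ∸ n ≡ n
2n∸n≡n n = trans (cong (_∸ n) (2*n≡n+n n)) (m+n∸m≡n n n)

n<2n : ∀ n → .{{NonZero n}} → n < 2 * n
n<2n n@(suc _) = subst (n <_) (sym (2*n≡n+n n)) (m<m+n n z<s)

central-binomial-factorials : ∀ n → ((2 * n) C n) * (n ! * n !) ≡ (2 * n) !
central-binomial-factorials n =
  subst (λ m → ((2 * n) C n) * (n ! * m !) ≡ (2 * n) !) (2n∸n≡n n)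
        (binomial-factorials (subst (n ≤_) (sym (2*n≡n+n n)) (m≤m+n n n)))

central-binomial≢0 : ∀ n → (2 * n) C n ≢ 0
central-binomial≢0 n x≡0 = ≢-nonZero⁻¹ ((2 * n) !) {{(2 * n) !≢0}} (begin
  (2 * n) !                     ≡⟨ central-binomial-factorials n ⟨
  ((2 * n) C n) * (n ! * n !)   ≡⟨ cong (_* (n ! * n !)) x≡0 ⟩
  0                             ∎)
  where open ≡-Reasoning

-- Kummer's theorem for the central binomial coefficient: ν₂ C(2n,n) = s(n).
-- From (2n)! = C(2n,n) · n! · n! and Legendre: ν₂ = (2n - s(2n)) - 2(n - s(n)).
ν₂-central-binomial : ∀ n → ν₂[ (2 * n) C n ]≡ s n
ν₂-central-binomial n with ν₂-exists ((2 * n) C n) (central-binomial≢0 n) | ν₂-factorial n | ν₂-factorial (2 * n)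
... | d , val-x | a , val-n! , legendre-n | c , val-2n! , legendre-2n = subst (ν₂[ (2 * n) C n ]≡_) d≡s val-x
  where
  open ≡-Reasoning
  d+2a≡c : d + (a + a) ≡ c
  d+2a≡c = ν₂-unique (subst (ν₂[_]≡ d + (a + a)) (central-binomial-factorials n)
                             (ν₂-mul {a = d} val-x (ν₂-mul {a = a} val-n! val-n!))) val-2n!
  rearrange : ∀ a t → (a + t) + (a + t) ≡ t + (a + a + t)
  rearrange = solve-∀
  d≡s : d ≡ s n
  d≡s = +-cancelʳ-≡ (a + a + s n) d (s n) (begin
    d + (a + a + s n)          ≡⟨ +-assoc d (a + a) (s n) ⟨
    d + (a + a) + s n          ≡⟨ cong (_+ s n) d+2a≡c ⟩
    c + s n                    ≡⟨ cong (c +_) (s-even n) ⟨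
    c + s (2 * n)              ≡⟨ legendre-2n ⟩
    2 * n                      ≡⟨ 2*n≡n+n n ⟩
    n + n                      ≡⟨ cong₂ _+_ legendre-n legendre-n ⟨
    (a + s n) + (a + s n)      ≡⟨ rearrange a (s n) ⟩
    s n + (a + a + s n)        ∎)

-- Catalan numbers

-- n + 1 divides C(2n,n): by absorption, C(2n,n) = (n+1)(C(2n,n) - C(2n,n+1)).
suc∣central-binomial : ∀ n → suc n ∣ (2 * n) C n
suc∣central-binomial zero = divides 1 refl
suc∣central-binomial n@(suc _) = divides (x ∸ y) (sym (begin
  (x ∸ y) * suc n              ≡⟨ *-distribʳ-∸ (suc n) x y ⟩
  x * suc n ∸ y * suc n        ≡⟨ cong₂ _∸_ (*-suc x n) (*-comm y (suc n)) ⟩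
  x + x * n ∸ suc n * y        ≡⟨ cong (x + x * n ∸_) (binomial-absorption (n<2n n)) ⟩
  x + x * n ∸ (2 * n ∸ n) * x  ≡⟨ cong (λ k → x + x * n ∸ k * x) (2n∸n≡n n) ⟩
  x + x * n ∸ n * x            ≡⟨ cong (x + x * n ∸_) (*-comm n x) ⟩
  x + x * n ∸ x * n            ≡⟨ m+n∸n≡m x (x * n) ⟩
  x                            ∎))
  where
  open ≡-Reasoning
  x = (2 * n) C n
  y = (2 * n) C suc n

catalan-mul : ∀ n → catalan n * suc n ≡ (2 * n) C n
catalan-mul n = m/n*n≡m (suc∣central-binomial n)

catalan≢0 : ∀ n → catalan n ≢ 0
catalan≢0 n c≡0 = central-binomial≢0 n (trans (sym (catalan-mul n)) (cong (_* suc n) c≡0))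

-- ν₂(C_n) = s(n+1) - 1, by comparing valuations in C_n · (n+1) = C(2n,n).
ν₂-catalan : ∀ n → ∃[ e ] ν₂[ catalan n ]≡ e × suc e ≡ s (suc n)
ν₂-catalan n with ν₂-exists (catalan n) (catalan≢0 n) | ν₂-suc n
... | e , val-c | b , val-suc , carry = e , val-c , +-cancelʳ-≡ b (suc e) (s (suc n)) (begin
  suc e + b        ≡⟨ cong suc e+b≡s ⟩
  suc (s n)        ≡⟨ +-comm 1 (s n) ⟩
  s n + 1          ≡⟨ carry ⟩
  s (suc n) + b    ∎)
  where
  open ≡-Reasoning
  e+b≡s : e + b ≡ s n
  e+b≡s = ν₂-unique (subst (ν₂[_]≡ e + b) (catalan-mul n) (ν₂-mul {a = e} val-c val-suc))
                    (ν₂-central-binomial n)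

-- Congruences modulo 2^(a+1)

module _ (a : ℕ) where
  private instance
    2^[1+a]≢0 : NonZero (2 ^ suc a)
    2^[1+a]≢0 = m^n≢0 2 (suc a)

  ν₂-congruence⇔ : ∀ c → (c % 2 ^ suc a ≡ 2 ^ a % 2 ^ suc a) ⇔ ν₂[ c ]≡ a
  ν₂-congruence⇔ c = mk⇔ from to
    where
    P = 2 ^ suc a
    split-odd : ∀ p q → p * suc (2 * q) ≡ p + q * (2 * p)
    split-odd = solve-∀
    2^a<P : 2 ^ a < P
    2^a<P = n<2n (2 ^ a) {{m^n≢0 2 a}}
    from : c % P ≡ 2 ^ a % P → ν₂[ c ]≡ a
    from c≡ = suc (2 * (c / P)) , (c / P , refl) , (begin
      c                        ≡⟨ m≡m%n+[m/n]*n c P ⟩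
      c % P + (c / P) * P      ≡⟨ cong (_+ (c / P) * P) (trans c≡ (m<n⇒m%n≡m 2^a<P)) ⟩
      2 ^ a + (c / P) * P      ≡⟨ split-odd (2 ^ a) (c / P) ⟨
      2 ^ a * suc (2 * (c / P)) ∎)
      where open ≡-Reasoning
    to : ν₂[ c ]≡ a → c % P ≡ 2 ^ a % P
    to (o , (q , o≡) , c≡) = begin
      c % P                    ≡⟨ cong (_% P) (trans c≡ (cong (2 ^ a *_) o≡)) ⟩
      2 ^ a * suc (2 * q) % P  ≡⟨ cong (_% P) (split-odd (2 ^ a) q) ⟩
      (2 ^ a + q * P) % P      ≡⟨ [m+kn]%n≡m%n (2 ^ a) q P ⟩
      2 ^ a % P                ∎
      where open ≡-Reasoning

  catalan-congruence⇔ : ∀ n → (catalan n % 2 ^ suc a ≡ 2 ^ a % 2 ^ suc a) ⇔ s (suc n) ≡ suc a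
  catalan-congruence⇔ n = mk⇔
    (λ c≡ → trans (sym e+1≡s) (cong suc (ν₂-unique {catalan n} val-c (Equivalence.to (ν₂-congruence⇔ (catalan n)) c≡))))
    (λ s≡ → Equivalence.from (ν₂-congruence⇔ (catalan n))
              (subst (ν₂[ catalan n ]≡_) (suc-injective (trans e+1≡s s≡)) val-c))
    where
    e = proj₁ (ν₂-catalan n)
    val-c : ν₂[ catalan n ]≡ e
    val-c = proj₁ (proj₂ (ν₂-catalan n))
    e+1≡s : suc e ≡ s (suc n)
    e+1≡s = proj₂ (proj₂ (ν₂-catalan n))

-- Counting

bit : Bool → ℕ
bit true  = 1
bit false = 0

count : (ℕ → Bool) → ℕ → ℕ
count P zero    = 0
count P (suc N) = bit (P 0) + count (λ n → P (suc n)) N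

count-cong : ∀ {P Q} N → (∀ n → P n ≡ Q n) → count P N ≡ count Q N
count-cong zero    P≗Q = refl
count-cong (suc N) P≗Q = cong₂ _+_ (cong bit (P≗Q 0)) (count-cong N (λ n → P≗Q (suc n)))

count-false : ∀ N → count (λ _ → false) N ≡ 0
count-false zero    = refl
count-false (suc N) = count-false N

length-filter-applyUpTo : ∀ {P : Pred ℕ 0ℓ} (P? : Decidable P) f N →
  length (filter P? (applyUpTo f N)) ≡ count (λ n → does (P? (f n))) N
length-filter-applyUpTo P? f zero = refl
length-filter-applyUpTo P? f (suc N) with does (P? (f 0))
... | true  = cong suc (length-filter-applyUpTo P? (λ n → f (suc n)) N)
... | false = length-filter-applyUpTo P? (λ n → f (suc n)) N

length-filter-positivesBelow : ∀ {P : Pred ℕ 0ℓ} (P? : Decidable P) N →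
  length (filter P? (positivesBelow N)) ≡ count (λ n → does (P? (suc n))) (pred N)
length-filter-positivesBelow P? zero    = refl
length-filter-positivesBelow P? (suc M) = length-filter-applyUpTo P? suc M

count-snoc : ∀ P N → count P (suc N) ≡ count P N + bit (P N)
count-snoc P zero    = +-comm (bit (P 0)) 0
count-snoc P (suc N) = trans (cong (bit (P 0) +_) (count-snoc (λ n → P (suc n)) N))
                             (sym (+-assoc (bit (P 0)) _ _))

count-rotate : ∀ P M → P 0 ≡ false → P 1 ≡ P (suc M) →
  count (λ n → P (suc (suc n))) M ≡ count P (suc M)
count-rotate P M P0≡false P1≡ = begin
  count (λ n → P (suc (suc n))) M     ≡⟨ +-cancelˡ-≡ (bit (P 1)) _ _ (begin
    bit (P 1) + count (λ n → P (suc (suc n))) M  ≡⟨ count-snoc (λ n → P (suc n)) M ⟩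
    count (λ n → P (suc n)) M + bit (P (suc M))  ≡⟨ cong (λ b → count (λ n → P (suc n)) M + bit b) P1≡ ⟨
    count (λ n → P (suc n)) M + bit (P 1)        ≡⟨ +-comm _ (bit (P 1)) ⟩
    bit (P 1) + count (λ n → P (suc n)) M        ∎) ⟩
  count (λ n → P (suc n)) M           ≡⟨ cong (λ b → bit b + count (λ n → P (suc n)) M) P0≡false ⟨
  count P (suc M)                     ∎
  where open ≡-Reasoning

count-even-odd : ∀ P N → count P (2 * N) ≡ count (λ j → P (2 * j)) N + count (λ j → P (suc (2 * j))) N
count-even-odd P zero    = refl
count-even-odd P (suc N) = begin
  count P (2 * suc N)                              ≡⟨ cong (count P) (double-suc N) ⟩
  bit (P 0) + (bit (P 1) + count P₂ (2 * N))        ≡⟨ cong (λ c → bit (P 0) + (bit (P 1) + c)) (count-even-odd P₂ N) ⟩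
  bit (P 0) + (bit (P 1) + (E + O))                 ≡⟨ interchange (bit (P 0)) (bit (P 1)) E O ⟩
  (bit (P 0) + E) + (bit (P 1) + O)                 ≡⟨ cong₂ (λ e o → (bit (P 0) + e) + (bit (P 1) + o))
                                                        (count-cong N (λ j → cong P (double-suc j)))
                                                        (count-cong N (λ j → cong (λ m → P (suc m)) (double-suc j))) ⟨
  count (λ j → P (2 * j)) (suc N) + count (λ j → P (suc (2 * j))) (suc N) ∎
  where
  open ≡-Reasoning
  P₂ = λ n → P (suc (suc n))
  E = count (λ j → P₂ (2 * j)) N
  O = count (λ j → P₂ (suc (2 * j))) N
  interchange : ∀ a b c d → a + (b + (c + d)) ≡ (a + c) + (b + d)
  interchange = solve-∀

-- Numbers with a given binary digit sum

hasDigitSum : ℕ → ℕ → Bool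
hasDigitSum k m = does (s m ≟ k)

-- An even number 2j has digit sum s(j), an odd one 2j + 1 has s(j) + 1.
count-by-last-digit : ∀ k N →
  count (hasDigitSum k) (2 * N) ≡ count (hasDigitSum k) N + count (λ j → does (suc (s j) ≟ k)) N
count-by-last-digit k N = trans (count-even-odd (hasDigitSum k) N)
  (cong₂ _+_ (count-cong N (λ j → cong (λ m → does (m ≟ k)) (s-even j)))
             (count-cong N (λ j → cong (λ m → does (m ≟ k)) (s-odd j))))

digitSum-count : ∀ t k → count (hasDigitSum k) (2 ^ t) ≡ t C k
digitSum-count zero    zero    = refl
digitSum-count zero    (suc k) = refl
digitSum-count (suc t) zero    = begin
  count (hasDigitSum 0) (2 * 2 ^ t)                   ≡⟨ count-by-last-digit 0 (2 ^ t) ⟩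
  count (hasDigitSum 0) (2 ^ t) + count (λ _ → false) (2 ^ t) ≡⟨ cong₂ _+_ (digitSum-count t 0) (count-false (2 ^ t)) ⟩
  t C 0 + 0                                          ≡⟨ +-identityʳ (t C 0) ⟩
  suc t C 0                                          ∎
  where open ≡-Reasoning
digitSum-count (suc t) (suc k) = begin
  count (hasDigitSum (suc k)) (2 * 2 ^ t)                            ≡⟨ count-by-last-digit (suc k) (2 ^ t) ⟩
  count (hasDigitSum (suc k)) (2 ^ t) + count (hasDigitSum k) (2 ^ t) ≡⟨ cong₂ _+_ (digitSum-count t (suc k)) (digitSum-count t k) ⟩
  t C suc k + t C k                                                  ≡⟨ +-comm (t C suc k) (t C k) ⟩
  t C k + t C suc k                                                  ≡⟨ nCk+nC[k+1]≡[n+1]C[k+1] t k ⟩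
  suc t C suc k                                                      ∎
  where open ≡-Reasoning

corollary4 : (t k : ℕ) → t ≥ 1 → k ≥ 1 → catalanCount t k ≡ t C k
corollary4 t zero    _ ()
corollary4 t (suc a) _ _ = begin
  catalanCount t (suc a)
    ≡⟨ length-filter-positivesBelow congruent? (2 ^ t) ⟩
  count (λ n → does (congruent? (suc n))) (pred (2 ^ t))
    ≡⟨ count-cong (pred (2 ^ t)) (λ n → does-⇔ (catalan-congruence⇔ a (suc n)) (congruent? (suc n)) (s (suc (suc n)) ≟ suc a)) ⟩
  count (λ n → hasDigitSum (suc a) (suc (suc n))) (pred (2 ^ t))
    ≡⟨ count-rotate (hasDigitSum (suc a)) (pred (2 ^ t)) refl (cong (λ m → does (m ≟ suc a)) s[1]≡s[2^t]) ⟩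
  count (hasDigitSum (suc a)) (suc (pred (2 ^ t)))
    ≡⟨ cong (count (hasDigitSum (suc a))) 2^t≡ ⟩
  count (hasDigitSum (suc a)) (2 ^ t)
    ≡⟨ digitSum-count t (suc a) ⟩
  t C suc a ∎
  where
  open ≡-Reasoning
  instance _ = m^n≢0 2 (suc a)
  congruent? : Decidable (λ n → catalan n % 2 ^ suc a ≡ 2 ^ a % 2 ^ suc a)
  congruent? n = catalan n % 2 ^ suc a ≟ 2 ^ a % 2 ^ suc a
  2^t≡ : suc (pred (2 ^ t)) ≡ 2 ^ t
  2^t≡ = suc-pred (2 ^ t) {{m^n≢0 2 t}}
  s[1]≡s[2^t] : s 1 ≡ s (suc (pred (2 ^ t)))
  s[1]≡s[2^t] = sym (trans (cong s 2^t≡) (s-pow2 t))
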